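{- Suppose that $n, k, d_1, d_2, \ldots, d_k$ are positive integers, $k>1$, $1\leq d_1 < d_2 < \cdots < d_k \leq n/2$, and $g$ is a common divisor of $n, d_1, d_2, \ldots, d_k$. Let $D=\{d_1, \ldots, d_k\}$ and $\frac{1}{g}D=\{d_1/g, \ldots, d_k/g\}$. Then $\chi(C_n, D) = \chi(C_{n/g}, \tfrac{1}{g}D)$.
   Context: For an integer $N\geq 3$, $C_N$ is the cycle with vertex set $\mathbb{Z}_N=\{0,1,\dots,N-1\}$, $i$ adjacent to $i\pm1 \pmod N$, with graph distance $\mathrm{dist}(i,j)=\min(|i-j|,\,N-|i-j|)$. For a set $D$ of positive integers, the distance graph $G(C_N,D)$ has vertex set $\mathbb{Z}_N$, with distinct $i,j$ adjacent iff $\mathrm{dist}(i,j)\in D$; $\chi(C_N,D)$ is its chromatic number. -}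

module Defs where

open import Data.Nat using (ℕ; zero; suc; _+_; _*_; _∸_; _≤_; _<_; _⊔_; _⊓_)
open import Data.Nat.Properties using ()
open import Data.Fin using (Fin; toℕ)
open import Data.Product using (Σ; ∃; _×_; _,_)
open import Relation.Binary.PropositionalEquality using (_≡_; _≢_)
open import Data.Nat.Base using (∣_-_∣)

cdist : (N : ℕ) → Fin N → Fin N → ℕ
cdist N i j = ∣ toℕ i - toℕ j ∣ ⊓ (N ∸ ∣ toℕ i - toℕ j ∣)

_∈D_ : {k : ℕ} → ℕ → (Fin k → ℕ) → Set
_∈D_ {k} x d = Σ (Fin k) (λ t → x ≡ d t)

Adj : (N : ℕ) {k : ℕ} (d : Fin k → ℕ) → Fin N → Fin N → Set
Adj N d i j = (i ≢ j) × (cdist N i j ∈D d)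

Colorable : (N : ℕ) {k : ℕ} (d : Fin k → ℕ) (c : ℕ) → Set
Colorable N d c =
  Σ (Fin N → Fin c) (λ f → ∀ i j → Adj N d i j → f i ≢ f j)

IsChromaticNumber : (N : ℕ) {k : ℕ} (d : Fin k → ℕ) (χ : ℕ) → Set
IsChromaticNumber N d χ = Colorable N d χ × (∀ c → Colorable N d c → χ ≤ c)

-- Both distance graphs are homomorphic images of each other: a ↦ g·a embeds
-- G(C_{n/g}, D/g) into G(C_n, D), and i ↦ ⌊i/g⌋ maps G(C_n, D) to G(C_{n/g}, D/g).
-- The second map preserves adjacency because two vertices at a cycle distance
-- divisible by g differ by a multiple of g, so dividing by g simply rescales
-- their cycle distance. Colourings pull back along homomorphisms, hence both
-- graphs are c-colourable for exactly the same c.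
module Submission where

open import Defs
open import Data.Nat using (ℕ; _*_; _≤_; _<_)
open import Data.Fin using (Fin) renaming (_<_ to _<ᶠ_)
open import Function.Bundles using (_⇔_)
open import Relation.Binary.PropositionalEquality using (_≡_)

open import Data.Nat using (suc; _+_; _∸_; _⊓_; ∣_-_∣; z≤n; s≤s; NonZero)
open import Data.Nat.Properties
open import Data.Nat.DivMod using (_/_; m/n*n≡m; m<n*o⇒m/o<n; +-distrib-/-∣ʳ)
open import Data.Nat.Divisibility using (_∣_; divides; n∣m*n; ∣m+n∣m⇒∣n)
open import Data.Fin using (toℕ; fromℕ<)
open import Data.Fin.Properties using (toℕ<n; toℕ-fromℕ<; toℕ-injective)
open import Data.Product using (Σ; _,_)
open import Data.Sum using (inj₁; inj₂)
open import Relation.Binary.PropositionalEquality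
  using (_≢_; refl; sym; trans; cong; cong₂; subst; module ≡-Reasoning)
open import Function.Base using (_∘_)
open import Function.Bundles using (mk⇔)

private
  variable
    k k' N N' c : ℕ

cycleNorm : ℕ → ℕ → ℕ
cycleNorm N δ = δ ⊓ (N ∸ δ)

cycleNorm-* : ∀ N g δ → cycleNorm (N * g) (δ * g) ≡ cycleNorm N δ * g
cycleNorm-* N g δ = begin
  (δ * g) ⊓ (N * g ∸ δ * g)    ≡⟨ cong ((δ * g) ⊓_) (*-distribʳ-∸ g N δ) ⟨
  (δ * g) ⊓ ((N ∸ δ) * g)      ≡⟨ *-distribʳ-⊓ g δ (N ∸ δ) ⟨
  (δ ⊓ (N ∸ δ)) * g            ∎
  where open ≡-Reasoning

cycleNorm≡*⇒∣ : ∀ N g δ D → δ ≤ N * g → cycleNorm (N * g) δ ≡ D * g → g ∣ δ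
cycleNorm≡*⇒∣ N g δ D δ≤Ng eq with ⊓-sel δ (N * g ∸ δ)
... | inj₁ norm≡δ = divides D (trans (sym norm≡δ) eq)
... | inj₂ norm≡rest = ∣m+n∣m⇒∣n g∣rest+δ (divides D (trans (sym norm≡rest) eq))
  where
  g∣rest+δ : g ∣ N * g ∸ δ + δ
  g∣rest+δ = subst (g ∣_) (sym (m∸n+n≡m δ≤Ng)) (n∣m*n N)

∣/-/∣*≡∣-∣-≤ : ∀ {g} .{{_ : NonZero g}} {x y} → y ≤ x → g ∣ x ∸ y →
               ∣ x / g - y / g ∣ * g ≡ ∣ x - y ∣
∣/-/∣*≡∣-∣-≤ {g} {x} {y} y≤x g∣x∸y = begin
  ∣ x / g - y / g ∣ * g                   ≡⟨ cong (λ z → ∣ z / g - y / g ∣ * g) (m+[n∸m]≡n y≤x) ⟨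
  ∣ (y + (x ∸ y)) / g - y / g ∣ * g       ≡⟨ cong (λ z → ∣ z - y / g ∣ * g) (+-distrib-/-∣ʳ y g∣x∸y) ⟩
  ∣ y / g + (x ∸ y) / g - y / g ∣ * g     ≡⟨ cong (_* g) (∣-∣-comm (y / g + (x ∸ y) / g) (y / g)) ⟩
  ∣ y / g - y / g + (x ∸ y) / g ∣ * g     ≡⟨ cong (_* g) (∣m-m+n∣≡n (y / g) ((x ∸ y) / g)) ⟩
  (x ∸ y) / g * g                         ≡⟨ m/n*n≡m g∣x∸y ⟩
  x ∸ y                                   ≡⟨ m≤n⇒∣n-m∣≡n∸m y≤x ⟨
  ∣ x - y ∣                               ∎
  where open ≡-Reasoning

∣/-/∣*≡∣-∣ : ∀ {g} .{{_ : NonZero g}} x y → g ∣ ∣ x - y ∣ →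
             ∣ x / g - y / g ∣ * g ≡ ∣ x - y ∣
∣/-/∣*≡∣-∣ x y g∣δ with ≤-total y x
... | inj₁ y≤x = ∣/-/∣*≡∣-∣-≤ y≤x (subst (_ ∣_) (m≤n⇒∣n-m∣≡n∸m y≤x) g∣δ)
... | inj₂ x≤y = begin
  ∣ x / _ - y / _ ∣ * _   ≡⟨ cong (_* _) (∣-∣-comm (x / _) (y / _)) ⟩
  ∣ y / _ - x / _ ∣ * _   ≡⟨ ∣/-/∣*≡∣-∣-≤ x≤y (subst (_ ∣_) (m≤n⇒∣m-n∣≡n∸m x≤y) g∣δ) ⟩
  ∣ y - x ∣               ≡⟨ ∣-∣-comm y x ⟩
  ∣ x - y ∣               ∎
  where open ≡-Reasoning

cycleNorm-/ : ∀ N g .{{_ : NonZero g}} x y D → x < N * g → y < N * g →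
              cycleNorm (N * g) ∣ x - y ∣ ≡ D * g →
              cycleNorm N ∣ x / g - y / g ∣ ≡ D
cycleNorm-/ N g x y D x<Ng y<Ng eq = *-cancelʳ-≡ _ D g (begin
  cycleNorm N ∣ x / g - y / g ∣ * g            ≡⟨ cycleNorm-* N g ∣ x / g - y / g ∣ ⟨
  cycleNorm (N * g) (∣ x / g - y / g ∣ * g)    ≡⟨ cong (cycleNorm (N * g)) (∣/-/∣*≡∣-∣ x y g∣δ) ⟩
  cycleNorm (N * g) ∣ x - y ∣                  ≡⟨ eq ⟩
  D * g                                        ∎)
  where
  open ≡-Reasoning
  δ≤Ng : ∣ x - y ∣ ≤ N * g
  δ≤Ng = ≤-trans (∣m-n∣≤m⊔n x y) (⊔-lub (<⇒≤ x<Ng) (<⇒≤ y<Ng))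
  g∣δ : g ∣ ∣ x - y ∣
  g∣δ = cycleNorm≡*⇒∣ N g ∣ x - y ∣ D δ≤Ng eq

Hom : (N : ℕ) (d : Fin k → ℕ) (N' : ℕ) (d' : Fin k' → ℕ) → Set
Hom N d N' d' = Σ (Fin N → Fin N') λ h → ∀ i j → Adj N d i j → Adj N' d' (h i) (h j)

Colorable-comap : {d : Fin k → ℕ} {d' : Fin k' → ℕ} →
                  Hom N d N' d' → Colorable N' d' c → Colorable N d c
Colorable-comap (h , h-adj) (f , proper) =
  (λ i → f (h i)) , λ i j adj → proper (h i) (h j) (h-adj i j adj)

Hom⇄⇒IsChromaticNumber⇔ : {d : Fin k → ℕ} {d' : Fin k' → ℕ} →
                          Hom N d N' d' → Hom N' d' N d →
                          ∀ χ → IsChromaticNumber N d χ ⇔ IsChromaticNumber N' d' χ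
Hom⇄⇒IsChromaticNumber⇔ there back χ =
  mk⇔ (λ (col , least) → Colorable-comap back col , λ c → least c ∘ Colorable-comap there)
      (λ (col , least) → Colorable-comap there col , λ c → least c ∘ Colorable-comap back)

cdist-self : ∀ N i → cdist N i i ≡ 0
cdist-self N i = cong (cycleNorm N) (∣n-n∣≡0 (toℕ i))

scaleHom : ∀ N' g .{{_ : NonZero g}} {d d' : Fin k → ℕ} →
           (∀ t → d t ≡ d' t * g) → Hom N' d' (N' * g) d
scaleHom N' g {d} {d'} d≡d'g = scale , scale-adj
  where
  scale : Fin N' → Fin (N' * g)
  scale a = fromℕ< (*-monoˡ-< g (toℕ<n a))

  toℕ-scale : ∀ a → toℕ (scale a) ≡ toℕ a * g
  toℕ-scale a = toℕ-fromℕ< _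

  scale-injective : ∀ {a b} → scale a ≡ scale b → a ≡ b
  scale-injective {a} {b} eq = toℕ-injective (*-cancelʳ-≡ _ _ g
    (trans (sym (toℕ-scale a)) (trans (cong toℕ eq) (toℕ-scale b))))

  scale-adj : ∀ a b → Adj N' d' a b → Adj (N' * g) d (scale a) (scale b)
  scale-adj a b (a≢b , t , dist≡) = a≢b ∘ scale-injective , t , (begin
    cdist (N' * g) (scale a) (scale b)            ≡⟨ cong₂ (λ x y → cycleNorm (N' * g) ∣ x - y ∣)
                                                           (toℕ-scale a) (toℕ-scale b) ⟩
    cycleNorm (N' * g) ∣ toℕ a * g - toℕ b * g ∣  ≡⟨ cong (cycleNorm (N' * g)) (*-distribʳ-∣-∣ g (toℕ a) (toℕ b)) ⟨
    cycleNorm (N' * g) (∣ toℕ a - toℕ b ∣ * g)    ≡⟨ cycleNorm-* N' g ∣ toℕ a - toℕ b ∣ ⟩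
    cdist N' a b * g                              ≡⟨ cong (_* g) dist≡ ⟩
    d' t * g                                      ≡⟨ d≡d'g t ⟨
    d t                                           ∎)
    where open ≡-Reasoning

quotientHom : ∀ N' g .{{_ : NonZero g}} {d d' : Fin k → ℕ} →
              (∀ t → 1 ≤ d t) → (∀ t → d t ≡ d' t * g) → Hom (N' * g) d N' d'
quotientHom N' g {d} {d'} d≥1 d≡d'g = quot , quot-adj
  where
  quot : Fin (N' * g) → Fin N'
  quot i = fromℕ< (m<n*o⇒m/o<n (toℕ<n i))

  toℕ-quot : ∀ i → toℕ (quot i) ≡ toℕ i / g
  toℕ-quot i = toℕ-fromℕ< _

  quot-adj : ∀ i j → Adj (N' * g) d i j → Adj N' d' (quot i) (quot j)
  quot-adj i j (_ , t , dist≡) = quot-distinct , t , dist'≡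
    where
    dist'≡ : cdist N' (quot i) (quot j) ≡ d' t
    dist'≡ = trans (cong₂ (λ x y → cycleNorm N' ∣ x - y ∣) (toℕ-quot i) (toℕ-quot j))
                   (cycleNorm-/ N' g (toℕ i) (toℕ j) (d' t) (toℕ<n i) (toℕ<n j) (trans dist≡ (d≡d'g t)))

    quot-distinct : quot i ≢ quot j
    quot-distinct eq = n≮0 (subst (1 ≤_) d≡0 (d≥1 t))
      where
      d'≡0 : d' t ≡ 0
      d'≡0 = trans (sym (subst (λ b → cdist N' (quot i) b ≡ d' t) (sym eq) dist'≡)) (cdist-self N' (quot i))
      d≡0 : d t ≡ 0
      d≡0 = trans (d≡d'g t) (cong (_* g) d'≡0)

proposition3p3p1 : (n k g n' : ℕ) (d d' : Fin k → ℕ) →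
    1 < k →
    (∀ t → 1 ≤ d t) →
    (∀ s t → s <ᶠ t → d s < d t) →
    (∀ t → 2 * d t ≤ n) →
    1 ≤ g →
    n ≡ n' * g →
    (∀ t → d t ≡ d' t * g) →
    ∀ χ → IsChromaticNumber n d χ ⇔ IsChromaticNumber n' d' χ
proposition3p3p1 .(n' * suc g) k (suc g) n' d d' _ d≥1 _ _ (s≤s z≤n) refl d≡d'g =
  Hom⇄⇒IsChromaticNumber⇔ (quotientHom n' (suc g) d≥1 d≡d'g) (scaleHom n' (suc g) d≡d'g)
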